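{- If $q$ is even, the $q-1$ $T$-sls-pencils and the $q-1$ $T$-planes can be matched so that each $T$-sls-pencil arches over exactly one $T$-plane, distinct pencils arching over distinct $T$-planes. If $q$ is odd, then each of the $\frac{q-1}{2}$ $T$-sls-pencils $T\mathcal S_\theta$ with $N(\theta)$ a nonzero square in $\mathbb{F}_q$ arches over exactly two of the $T$-planes, and each of the remaining $\frac{q-1}{2}$ $T$-sls-pencils arches over no $T$-plane.
   Context: Let $q$ be a prime power, $\mathbb{F}_{q^3}^*=\mathbb{F}_{q^3}\setminus\{0\}$, $N(x)=x^{q^2+q+1}$. Points of $\mathrm{PG}(2,q^3)$ have coordinates $(x,y,z)$, lines $[a,b,c]$, incidence iff $ax+by+cz=0$. Let $T=(0,0,1)$. For $\theta\in\mathbb{F}_{q^3}^*$ let $\mathcal S_\theta=\{(x\theta,x^q,0):x\in\mathbb{F}_{q^3}^*\}$ (there are $q-1$ distinct such sets, $\mathcal S_\theta=\mathcal S_\kappa$ iff $N(\theta)=N(\kappa)$) and let the $T$-sls-pencil $T\mathcal S_\theta=\{TX:X\in\mathcal S_\theta\}$. The $T$-planes are the sets $\Pi_\theta=\{(r\theta^{q+1},r^q,r^{q^2}\theta):r\in\mathbb{F}_{q^3}^*\}$, $\theta\in\mathbb{F}_{q^3}^*$ (there are $q-1$ distinct ones, $\Pi_\theta=\Pi_\kappa$ iff $N(\theta)=N(\kappa)$). A $T$-sls-pencil arches over a $T$-plane if each of its $q^2+q+1$ lines contains exactly one point of the $T$-plane. -}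

module Defs where

open import Level using (0ℓ)
open import Data.Nat using (ℕ; zero; suc; _≥_) renaming (_+_ to _+ℕ_; _*_ to _*ℕ_; _^_ to _^ℕ_)
open import Data.Nat.Primality using (Prime)
open import Data.Product using (Σ; _×_; _,_; ∃)
open import Relation.Nullary using (¬_)
open import Relation.Binary.PropositionalEquality using (_≡_)
open import Algebra.Structures using (IsCommutativeRing)

IsPrimePower : ℕ → Set
IsPrimePower q = Σ ℕ λ p → Σ ℕ λ k → Prime p × k ≥ 1 × q ≡ p ^ℕ k

record Fld : Set₁ where
  infixl 6 _+_ _-_
  infixl 7 _*_
  field
    Carrier : Set
    _+_ _*_ : Carrier → Carrier → Carrier
    -_ : Carrier → Carrier
    0# 1# : Carrier
    isCommutativeRing : IsCommutativeRing _≡_ _+_ _*_ -_ 0# 1#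
    0≢1 : ¬ (0# ≡ 1#)
    inverse : ∀ x → ¬ (x ≡ 0#) → Σ Carrier λ y → x * y ≡ 1#
  _-_ : Carrier → Carrier → Carrier
  x - y = x + (- y)

module FieldGeometry (F : Fld) (q : ℕ) where
  open Fld F

  infixr 8 _^_
  _^_ : Carrier → ℕ → Carrier
  x ^ zero = 1#
  x ^ suc n = x * (x ^ n)

  NonZero : Carrier → Set
  NonZero x = ¬ (x ≡ 0#)

  F* : Set
  F* = Σ Carrier NonZero

  N : Carrier → Carrier
  N x = x ^ (q *ℕ q +ℕ q +ℕ 1)

  InFq : Carrier → Set
  InFq a = a ^ q ≡ a

  NonzeroSquareInFq : Carrier → Set
  NonzeroSquareInFq a = NonZero a × InFq a × Σ Carrier λ b → InFq b × b * b ≡ a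

  -- homogeneous coordinate triples (used both for points (x,y,z) and lines [a,b,c])
  Triple : Set
  Triple = Carrier × Carrier × Carrier

  scale : Carrier → Triple → Triple
  scale l (x , y , z) = (l * x , l * y , l * z)

  ProjEq : Triple → Triple → Set
  ProjEq P Q = Σ Carrier λ l → NonZero l × P ≡ scale l Q

  Incident : Triple → Triple → Set
  Incident (a , b , c) (x , y , z) = a * x + b * y + c * z ≡ 0#

  -- the line joining two distinct points (cross product of coordinates)
  join : Triple → Triple → Triple
  join (x₁ , y₁ , z₁) (x₂ , y₂ , z₂) =
    (y₁ * z₂ - z₁ * y₂ , z₁ * x₂ - x₁ * z₂ , x₁ * y₂ - y₁ * x₂)

  T : Triple
  T = (0# , 0# , 1#)

  Spt : Carrier → Carrier → Triple
  Spt θ x = (x * θ , x ^ q , 0#)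

  Ppt : Carrier → Carrier → Triple
  Ppt θ r = (r * θ ^ (q +ℕ 1) , r ^ q , r ^ (q *ℕ q) * θ)

  pencilLine : Carrier → Carrier → Triple
  pencilLine θ x = join T (Spt θ x)

  InPlane : Carrier → Triple → Set
  InPlane κ P = Σ F* λ r → ProjEq P (Ppt κ (Σ.proj₁ r))
    where open Σ

  SamePlane : Carrier → Carrier → Set
  SamePlane κ κ' = ∀ P → (InPlane κ P → InPlane κ' P) × (InPlane κ' P → InPlane κ P)

  InPencil : Carrier → Triple → Set
  InPencil θ ℓ = Σ F* λ x → ProjEq ℓ (pencilLine θ (Σ.proj₁ x))

  SamePencil : Carrier → Carrier → Set
  SamePencil θ θ' = ∀ ℓ → (InPencil θ ℓ → InPencil θ' ℓ) × (InPencil θ' ℓ → InPencil θ ℓ)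

  -- T S_θ arches over Π_κ: every line TX (X ∈ S_θ) contains exactly one
  -- point of Π_κ (existence, and any two such points coincide projectively)
  Arches : Carrier → Carrier → Set
  Arches θ κ = (x : F*) →
      (Σ F* λ r → Incident (pencilLine θ (Σ.proj₁ x)) (Ppt κ (Σ.proj₁ r)))
    × ((r r' : F*) → Incident (pencilLine θ (Σ.proj₁ x)) (Ppt κ (Σ.proj₁ r))
                   → Incident (pencilLine θ (Σ.proj₁ x)) (Ppt κ (Σ.proj₁ r'))
                   → ProjEq (Ppt κ (Σ.proj₁ r)) (Ppt κ (Σ.proj₁ r')))

{-# OPTIONS --safe #-}
module Submission where

-- The line of T S_θ through X = (xθ, x^q, 0) meets Π_κ in the point with parameter r
-- exactly when xθ r^q = x^q r κ^(q+1). Taking norms at x = 1 shows that T S_θ can arch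
-- over Π_κ only if N(κ)² = N(θ). Conversely, if N(κ)² = N(θ) then for every x the
-- solutions r are the (q-1)-th roots of an element of norm 1, which exist by Hilbert 90
-- (norm-one elements of F_(q³) are (q-1)-th powers) and differ by factors in F_q, i.e.
-- give one projective point. Likewise Π_κ = Π_κ' iff N(κ) = N(κ'), and T S_θ = T S_θ' when
-- N(θ) = N(θ'), the norm being onto F_q*. So T S_θ arches over Π_κ iff N(κ) is a square
-- root of N(θ) in F_q*, and the corollary counts square roots in F_q*: squaring is
-- bijective in characteristic 2, while for odd q a nonzero square b² has exactly the two
-- roots ±b. Hilbert 90 and the surjectivity of N follow by counting roots of x^d = c.

open import Defs
open import Level using (0ℓ)
open import Algebra.Bundles using (CommutativeRing; CommutativeSemiring; CommutativeMonoid)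
open import Data.Nat as ℕ using (ℕ; zero; suc; _≤_; _<_; z≤n; s≤s; _%_; _/_)
import Data.Nat.Properties as ℕₚ
open import Data.Nat.Solver using (module +-*-Solver)
open import Data.Nat.DivMod using (m≡m%n+[m/n]*n)
open import Data.Nat.Divisibility using (_∣_; m%n≡0⇒n∣m; ∣1⇒≡1)
open import Data.Nat.Primality using (Prime; euclidsLemma; prime[2]; ¬prime[0]; ¬prime[1]; prime⇒irreducible)
open import Data.Fin using (Fin)
import Data.Fin.Properties as Fin
open import Data.Empty using (⊥-elim)
open import Data.Product using (Σ; _×_; _,_; proj₁; proj₂)
open import Data.Sum as Sum using (_⊎_; inj₁; inj₂; [_,_]′)
open import Data.Vec using (Vec; []; _∷_; replicate)
open import Data.List using (List; []; _∷_; length; map; filter; foldr; tabulate)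
open import Data.List.Properties using (length-tabulate; filter-notAll)
open import Data.List.Relation.Unary.All as All using (All; []; _∷_)
open import Data.List.Relation.Unary.All.Properties using (all-filter; ¬Any⇒All¬) renaming (filter⁺ to All-filter⁺)
open import Data.List.Relation.Unary.Any as Any using (here; there; any?)
open import Data.List.Relation.Unary.AllPairs using (_∷_)
open import Data.List.Relation.Unary.Unique.Propositional using (Unique)
import Data.List.Relation.Unary.Unique.Propositional.Properties as Unique
open import Data.List.Membership.Propositional using (_∈_; find)
open import Data.List.Membership.Propositional.Properties using (∈-map⁺; ∈-map⁻; ∈-filter⁺; ∈-filter⁻; ∈-tabulate⁺)
open import Data.List.Membership.Propositional.Properties.WithK using (unique∧set⇒bag)
open import Data.List.Relation.Binary.BagAndSetEquality using (∼bag⇒↭)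
open import Data.List.Relation.Binary.Permutation.Propositional using (_↭_; ↭⇒↭ₛ′)
open import Data.List.Relation.Binary.Permutation.Propositional.Properties using (↭-length)
import Data.List.Relation.Binary.Permutation.Setoid.Properties as Permutationₛ
open import Function using (id; _∘_; _↔_; _⇔_; mk⇔; Equivalence; Inverse; Injection)
open import Function.Properties.Inverse using (↔-sym; ↔⇒↣)
open import Relation.Nullary using (¬_; Dec; yes; no; ¬?)
open import Relation.Nullary.Decidable using (via-injection)
open import Relation.Unary using (Pred; Decidable)
open import Relation.Binary.Definitions using (DecidableEquality)
open import Relation.Binary.PropositionalEquality
  using (_≡_; _≢_; refl; sym; trans; cong; cong₂; subst; module ≡-Reasoning)

module FieldProperties (F : Fld) where
  open Fld F public

  commutativeRing : CommutativeRing 0ℓ 0ℓ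
  commutativeRing = record { isCommutativeRing = isCommutativeRing }

  open CommutativeRing commutativeRing public
    using ( +-assoc; +-comm; +-identityˡ; +-identityʳ; -‿inverseˡ; -‿inverseʳ
          ; *-assoc; *-comm; *-identityˡ; *-identityʳ; zeroˡ; zeroʳ; distribʳ
          ; semiring; commutativeSemiring
          ; +-commutativeMonoid; *-commutativeMonoid )
  open import Algebra.Properties.Ring (CommutativeRing.ring commutativeRing) public
    using ( -‿distribˡ-*; -‿distribʳ-*; -‿involutive; -1*x≈-x; -0#≈0#
          ; +-cancelˡ; +-inverseˡ-unique; +-identityˡ-unique; x∙y⁻¹≈ε⇒x≈y; x≈y⇒x∙y⁻¹≈ε )
  open import Algebra.Definitions.RawSemiring (CommutativeSemiring.rawSemiring commutativeSemiring) public
    using (_^_) renaming (_×_ to _·_)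
  open import Algebra.Properties.CommutativeSemiring.Exp commutativeSemiring public
    using (^-homo-*; ^-assocʳ; ^-distrib-*)
  open import Algebra.Properties.Semiring.Mult semiring public
    using (×1-homo-*)
  open import Algebra.Solver.Ring.NaturalCoefficients.Default commutativeSemiring
    using (solve; _:=_; _:+_; _:*_; con)
  open ≡-Reasoning

  1≢0 : 1# ≢ 0#
  1≢0 = 0≢1 ∘ sym

  quotient : ∀ {a} → a ≢ 0# → ∀ b → Σ Carrier λ c → b ≡ c * a
  quotient {a} a≢0 b = b * a⁻¹ , (begin
    b                ≡⟨ *-identityʳ b ⟨
    b * 1#           ≡⟨ cong (b *_) a*a⁻¹≡1 ⟨
    b * (a * a⁻¹)    ≡⟨ solve 3 (λ b a i → b :* (a :* i) := (b :* i) :* a) refl b a a⁻¹ ⟩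
    b * a⁻¹ * a      ∎)
    where
    a⁻¹ : Carrier
    a⁻¹ = proj₁ (inverse a a≢0)
    a*a⁻¹≡1 : a * a⁻¹ ≡ 1#
    a*a⁻¹≡1 = proj₂ (inverse a a≢0)

  *-cancelʳ : ∀ {a b c} → a ≢ 0# → b * a ≡ c * a → b ≡ c
  *-cancelʳ {a} {b} {c} a≢0 ba≡ca = begin
    b              ≡⟨ *-identityʳ b ⟨
    b * 1#         ≡⟨ cong (b *_) 1≡a⁻¹a ⟩
    b * (a⁻¹ * a)  ≡⟨ y[a⁻¹a]≡ya[a⁻¹] b ⟩
    b * a * a⁻¹    ≡⟨ cong (_* a⁻¹) ba≡ca ⟩
    c * a * a⁻¹    ≡⟨ y[a⁻¹a]≡ya[a⁻¹] c ⟨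
    c * (a⁻¹ * a)  ≡⟨ cong (c *_) 1≡a⁻¹a ⟨
    c * 1#         ≡⟨ *-identityʳ c ⟩
    c              ∎
    where
    a⁻¹ : Carrier
    a⁻¹ = proj₁ (quotient a≢0 1#)
    1≡a⁻¹a : 1# ≡ a⁻¹ * a
    1≡a⁻¹a = proj₂ (quotient a≢0 1#)
    y[a⁻¹a]≡ya[a⁻¹] : ∀ y → y * (a⁻¹ * a) ≡ y * a * a⁻¹
    y[a⁻¹a]≡ya[a⁻¹] y = solve 3 (λ y i a → y :* (i :* a) := (y :* a) :* i) refl y a⁻¹ a

  *-cancelˡ : ∀ {a b c} → a ≢ 0# → a * b ≡ a * c → b ≡ c
  *-cancelˡ {a} {b} {c} a≢0 ab≡ac = *-cancelʳ a≢0 (trans (*-comm b a) (trans ab≡ac (*-comm a c)))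

  *-nonZero : ∀ {a b} → a ≢ 0# → b ≢ 0# → a * b ≢ 0#
  *-nonZero {a} {b} a≢0 b≢0 ab≡0 = b≢0 (*-cancelˡ a≢0 (trans ab≡0 (sym (zeroʳ a))))

  -‿nonZero : ∀ {x} → x ≢ 0# → - x ≢ 0#
  -‿nonZero {x} x≢0 -x≡0 = x≢0 (trans (sym (-‿involutive x)) (trans (cong -_ -x≡0) -0#≈0#))

  square-nonZero⇒nonZero : ∀ {x} → x * x ≢ 0# → x ≢ 0#
  square-nonZero⇒nonZero {x} xx≢0 x≡0 = xx≢0 (trans (cong (_* x) x≡0) (zeroˡ x))

  quotient-nonZero : ∀ {a b c} → b ≢ 0# → b ≡ c * a → c ≢ 0#
  quotient-nonZero {a} b≢0 b≡ca c≡0 = b≢0 (trans b≡ca (trans (cong (_* a) c≡0) (zeroˡ a)))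

  x≢y∧xz≡yz⇒z≡0 : ∀ {x y z} → x ≢ y → x * z ≡ y * z → z ≡ 0#
  x≢y∧xz≡yz⇒z≡0 {x} {y} {z} x≢y xz≡yz = *-cancelˡ x-y≢0 (begin
    (x - y) * z        ≡⟨ distribʳ z x (- y) ⟩
    x * z + - y * z    ≡⟨ cong (x * z +_) (-‿distribˡ-* y z) ⟨
    x * z - y * z      ≡⟨ x≈y⇒x∙y⁻¹≈ε xz≡yz ⟩
    0#                 ≡⟨ zeroʳ (x - y) ⟨
    (x - y) * 0#       ∎)
    where
    x-y≢0 : x - y ≢ 0#
    x-y≢0 = x≢y ∘ x∙y⁻¹≈ε⇒x≈y x y

  ^-nonZero : ∀ {x} n → x ≢ 0# → x ^ n ≢ 0#
  ^-nonZero zero    x≢0 = 1≢0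
  ^-nonZero (suc n) x≢0 = *-nonZero x≢0 (^-nonZero n x≢0)

  ·1-homo-^ : ∀ a k → (a ℕ.^ k) · 1# ≡ (a · 1#) ^ k
  ·1-homo-^ a zero    = +-identityʳ 1#
  ·1-homo-^ a (suc k) = trans (×1-homo-* a (a ℕ.^ k)) (cong ((a · 1#) *_) (·1-homo-^ a k))

  -x*-y≡x*y : ∀ x y → - x * - y ≡ x * y
  -x*-y≡x*y x y = begin
    - x * - y       ≡⟨ -‿distribˡ-* x (- y) ⟨
    - (x * - y)     ≡⟨ cong -_ (-‿distribʳ-* x y) ⟨
    - (- (x * y))   ≡⟨ -‿involutive (x * y) ⟩
    x * y           ∎

  1+1≡0⇒-x≡x : 1# + 1# ≡ 0# → ∀ x → - x ≡ x
  1+1≡0⇒-x≡x 1+1≡0 x = sym (+-inverseˡ-unique x x (begin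
    x + x             ≡⟨ solve 1 (λ x → x :+ x := (con 1 :+ con 1) :* x) refl x ⟩
    (1# + 1#) * x     ≡⟨ cong (_* x) 1+1≡0 ⟩
    0# * x            ≡⟨ zeroˡ x ⟩
    0#                ∎))

  1+1≢0⇒x≢-x : 1# + 1# ≢ 0# → ∀ {x} → x ≢ 0# → x ≢ - x
  1+1≢0⇒x≢-x 1+1≢0 {x} x≢0 x≡-x = 1+1≢0 (*-cancelʳ x≢0 (begin
    (1# + 1#) * x     ≡⟨ solve 1 (λ x → (con 1 :+ con 1) :* x := x :+ x) refl x ⟩
    x + x             ≡⟨ cong (_+ x) x≡-x ⟩
    - x + x           ≡⟨ -‿inverseˡ x ⟩
    0#                ≡⟨ zeroˡ x ⟨
    0# * x            ∎))

  module _ (_≟_ : DecidableEquality Carrier) where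

    ^≡0⇒≡0 : ∀ {x} n → x ^ n ≡ 0# → x ≡ 0#
    ^≡0⇒≡0 {x} n x^n≡0 with x ≟ 0#
    ... | yes x≡0 = x≡0
    ... | no  x≢0 = ⊥-elim (^-nonZero n x≢0 x^n≡0)

    square≡square⇒≡± : ∀ {x y} → x * x ≡ y * y → x ≡ y ⊎ x ≡ - y
    square≡square⇒≡± {x} {y} xx≡yy with (x - y) ≟ 0#
    ... | yes x-y≡0 = inj₁ (x∙y⁻¹≈ε⇒x≈y x y x-y≡0)
    ... | no  x-y≢0 = inj₂ (+-inverseˡ-unique x y (*-cancelˡ x-y≢0 (begin
      (x - y) * (x + y)           ≡⟨ solve 3 (λ x y -y → (x :+ -y) :* (x :+ y) := x :* x :+ -y :* y :+ (y :+ -y) :* x)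
                                             refl x y (- y) ⟩
      x * x + - y * y + (y - y) * x ≡⟨ cong₂ (λ s t → s + - y * y + t * x) xx≡yy (-‿inverseʳ y) ⟩
      y * y + - y * y + 0# * x    ≡⟨ cong₂ (λ s t → y * y + s + t) (-‿distribˡ-* y y) (sym (zeroˡ x)) ⟨
      y * y - y * y + 0#          ≡⟨ trans (+-identityʳ _) (-‿inverseʳ (y * y)) ⟩
      0#                          ≡⟨ zeroʳ (x - y) ⟨
      (x - y) * 0#                ∎)))

module MonicPolynomial (F : Fld) where
  open FieldProperties F
  open import Algebra.Solver.Ring.NaturalCoefficients.Default commutativeSemiring
    using (solve; _:=_; _:+_; _:*_; con)
  open ≡-Reasoning

  -- c₀ ∷ c₁ ∷ … ∷ c₍d₋₁₎ stands for the monic polynomial c₀ + c₁ x + … + c₍d₋₁₎ x^(d-1) + x^d,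
  -- so a polynomial of this type has degree exactly d.
  eval : ∀ {d} → Vec Carrier d → Carrier → Carrier
  eval []       x = 1#
  eval (c ∷ cs) x = c + x * eval cs x

  Root : ∀ {d} → Vec Carrier d → Carrier → Set
  Root p x = eval p x ≡ 0#

  -- Synthetic division by x - a.
  divide : ∀ {d} → Carrier → Vec Carrier (suc d) → Vec Carrier d
  divide a (c ∷ [])         = []
  divide a (c ∷ cs@(_ ∷ _)) = eval cs a ∷ divide a cs

  -- p(x) = (x - a) (p / (x - a))(x) + p(a), with the subtraction moved to the other side.
  eval-divide : ∀ {d} a (p : Vec Carrier (suc d)) x →
                eval p x + a * eval (divide a p) x ≡ x * eval (divide a p) x + eval p a
  eval-divide a (c ∷ []) x =
    solve 3 (λ c x a → (c :+ x :* con 1) :+ a :* con 1 := x :* con 1 :+ (c :+ a :* con 1)) refl c x a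
  eval-divide a (c ∷ cs@(_ ∷ _)) x = begin
    c + x * eval cs x + a * (eval cs a + x * Q)       ≡⟨ solve 6 (λ c x P a E Q →
                                                            c :+ x :* P :+ a :* (E :+ x :* Q)
                                                         := c :+ x :* (P :+ a :* Q) :+ a :* E) refl c x (eval cs x) a (eval cs a) Q ⟩
    c + x * (eval cs x + a * Q) + a * eval cs a       ≡⟨ cong (λ t → c + x * t + a * eval cs a) (eval-divide a cs x) ⟩
    c + x * (x * Q + eval cs a) + a * eval cs a       ≡⟨ solve 5 (λ c x Q E a →
                                                            c :+ x :* (x :* Q :+ E) :+ a :* E
                                                         := x :* (E :+ x :* Q) :+ (c :+ a :* E)) refl c x Q (eval cs a) a ⟩
    x * (eval cs a + x * Q) + (c + a * eval cs a)     ∎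
    where
    Q : Carrier
    Q = eval (divide a cs) x

  divide-root : ∀ {d} {a b} (p : Vec Carrier (suc d)) → Root p a → Root p b → a ≢ b → Root (divide a p) b
  divide-root {a = a} {b} p pa≡0 pb≡0 a≢b = x≢y∧xz≡yz⇒z≡0 a≢b (begin
    a * Q            ≡⟨ +-identityˡ (a * Q) ⟨
    0# + a * Q       ≡⟨ cong (λ t → t + a * Q) pb≡0 ⟨
    eval p b + a * Q ≡⟨ eval-divide a p b ⟩
    b * Q + eval p a ≡⟨ cong (b * Q +_) pa≡0 ⟩
    b * Q + 0#       ≡⟨ +-identityʳ (b * Q) ⟩
    b * Q            ∎)
    where
    Q : Carrier
    Q = eval (divide a p) b

  roots-length≤degree : ∀ {d} (p : Vec Carrier d) {xs : List Carrier} →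
                        Unique xs → All (Root p) xs → length xs ≤ d
  roots-length≤degree p        {[]}     _              _            = z≤n
  roots-length≤degree []       {x ∷ xs} _              (1≡0 ∷ _)    = ⊥-elim (1≢0 1≡0)
  roots-length≤degree p@(_ ∷ _) {x ∷ xs} (x∉xs ∷ xs-unique) (px≡0 ∷ roots) =
    s≤s (roots-length≤degree (divide x p) xs-unique
          (All.zipWith (λ (x≢y , py≡0) → divide-root p px≡0 py≡0 x≢y) (x∉xs , roots)))

  ^≡-solutions-length≤ : ∀ d c {xs : List Carrier} → Unique xs → All (λ x → x ^ suc d ≡ c) xs →
                         length xs ≤ suc d
  ^≡-solutions-length≤ d c xs-unique sols =
    roots-length≤degree (- c ∷ replicate d 0#) xs-unique (All.map root sols)
    where
    eval-zeros : ∀ k x → eval (replicate k 0#) x ≡ x ^ k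
    eval-zeros zero    x = refl
    eval-zeros (suc k) x = trans (+-identityˡ _) (cong (x *_) (eval-zeros k x))
    root : ∀ {x} → x ^ suc d ≡ c → Root (- c ∷ replicate d 0#) x
    root {x} x^d+1≡c = begin
      - c + x * eval (replicate d 0#) x ≡⟨ cong (λ t → - c + x * t) (eval-zeros d x) ⟩
      - c + x ^ suc d                   ≡⟨ cong (- c +_) x^d+1≡c ⟩
      - c + c                           ≡⟨ -‿inverseˡ c ⟩
      0#                                ∎

module _ {A : Set} where

  unique∧set⇒↭ : ∀ {xs ys : List A} → Unique xs → Unique ys →
                 (∀ {z} → z ∈ xs → z ∈ ys) → (∀ {z} → z ∈ ys → z ∈ xs) → xs ↭ ys
  unique∧set⇒↭ xs-unique ys-unique xs⊆ys ys⊆xs =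
    ∼bag⇒↭ (unique∧set⇒bag xs-unique ys-unique (mk⇔ xs⊆ys ys⊆xs))

  length-filter+length-filter¬ : ∀ {P : Pred A 0ℓ} (P? : Decidable P) xs →
    length (filter P? xs) ℕ.+ length (filter (¬? ∘ P?) xs) ≡ length xs
  length-filter+length-filter¬ P? []       = refl
  length-filter+length-filter¬ P? (x ∷ xs) with P? x
  ... | yes _ = cong suc (length-filter+length-filter¬ P? xs)
  ... | no  _ = trans (ℕₚ.+-suc _ _) (cong suc (length-filter+length-filter¬ P? xs))

module _ {A B : Set} (_≟_ : DecidableEquality B) (f : A → B) (k : ℕ)
         (fibre-bound : ∀ b {zs} → Unique zs → All (λ z → f z ≡ b) zs → length zs ≤ k) where

  pigeonhole : ∀ ys {xs} → Unique xs → All (λ x → f x ∈ ys) xs → length xs ≤ length ys ℕ.* k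
  pigeonhole []       {[]}    _         _        = z≤n
  pigeonhole []       {_ ∷ _} _         (() ∷ _)
  pigeonhole (b ∷ ys) {xs}    xs-unique xs↦b∷ys = begin
    length xs                                                     ≡⟨ length-filter+length-filter¬ hits? xs ⟨
    length (filter hits? xs) ℕ.+ length (filter (¬? ∘ hits?) xs)  ≤⟨ ℕₚ.+-mono-≤ hits≤k misses≤|ys|k ⟩
    k ℕ.+ length ys ℕ.* k                                         ∎
    where
    open ℕₚ.≤-Reasoning
    hits? : ∀ x → Dec (f x ≡ b)
    hits? x = f x ≟ b
    hits≤k : length (filter hits? xs) ≤ k
    hits≤k = fibre-bound b (Unique.filter⁺ hits? xs-unique) (all-filter hits? xs)
    misses↦ys : All (λ x → f x ∈ ys) (filter (¬? ∘ hits?) xs)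
    misses↦ys = All.zipWith (λ { (here fx≡b , fx≢b) → ⊥-elim (fx≢b fx≡b) ; (there fx∈ys , _) → fx∈ys })
                  (All-filter⁺ (¬? ∘ hits?) xs↦b∷ys , all-filter (¬? ∘ hits?) xs)
    misses≤|ys|k : length (filter (¬? ∘ hits?) xs) ≤ length ys ℕ.* k
    misses≤|ys|k = pigeonhole ys (Unique.filter⁺ (¬? ∘ hits?) xs-unique) misses↦ys

module _ {a ℓ} (M : CommutativeMonoid a ℓ) where
  open CommutativeMonoid M
    using (Carrier; _≈_; _∙_; ε; ∙-congˡ; identityˡ; isEquivalence; isCommutativeMonoid; rawMonoid)
    renaming (setoid to ≈-setoid; sym to ≈-sym; refl to ≈-refl)
  open import Algebra.Definitions.RawMonoid rawMonoid using () renaming (_×_ to _·_)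
  open import Algebra.Solver.CommutativeMonoid M using (solve; _⊕_; _⊜_)
  open import Relation.Binary.Reasoning.Setoid ≈-setoid

  foldr-map-∙ˡ : ∀ x xs → foldr _∙_ ε (map (x ∙_) xs) ≈ (length xs · x) ∙ foldr _∙_ ε xs
  foldr-map-∙ˡ x []       = ≈-sym (identityˡ ε)
  foldr-map-∙ˡ x (y ∷ ys) = begin
    (x ∙ y) ∙ foldr _∙_ ε (map (x ∙_) ys)   ≈⟨ ∙-congˡ (foldr-map-∙ˡ x ys) ⟩
    (x ∙ y) ∙ ((length ys · x) ∙ S)         ≈⟨ solve 4 (λ x y n s → (x ⊕ y) ⊕ (n ⊕ s) ⊜ (x ⊕ n) ⊕ (y ⊕ s))
                                                        ≈-refl x y (length ys · x) S ⟩
    (x ∙ (length ys · x)) ∙ (y ∙ S)         ∎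
    where
    S : Carrier
    S = foldr _∙_ ε ys

  foldr-translation-invariant : ∀ {x xs} → xs ↭ map (x ∙_) xs →
                                (length xs · x) ∙ foldr _∙_ ε xs ≈ foldr _∙_ ε xs
  foldr-translation-invariant {x} {xs} xs↭x∙xs = ≈-sym (begin
    foldr _∙_ ε xs                     ≈⟨ Permutationₛ.foldr-commMonoid ≈-setoid isCommutativeMonoid
                                                 (↭⇒↭ₛ′ isEquivalence xs↭x∙xs) ⟩
    foldr _∙_ ε (map (x ∙_) xs)        ≈⟨ foldr-map-∙ˡ x xs ⟩
    (length xs · x) ∙ foldr _∙_ ε xs   ∎)

module FiniteField (F : Fld) {m : ℕ} (enumeration : Fin (suc m) ↔ Fld.Carrier F) where
  open FieldProperties F
  open MonicPolynomial F using (^≡-solutions-length≤)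
  open Inverse enumeration using (to; from; strictlyInverseˡ)

  infix 4 _≟_
  _≟_ : DecidableEquality Carrier
  _≟_ = via-injection (↔⇒↣ (↔-sym enumeration)) Fin._≟_

  elements : List Carrier
  elements = tabulate to

  elements-unique : Unique elements
  elements-unique = Unique.tabulate⁺ (Injection.injective (↔⇒↣ enumeration))

  ∈-elements : ∀ x → x ∈ elements
  ∈-elements x = subst (_∈ elements) (strictlyInverseˡ x) (∈-tabulate⁺ {f = to} (from x))

  units : List Carrier
  units = filter (λ x → ¬? (x ≟ 0#)) elements

  units-unique : Unique units
  units-unique = Unique.filter⁺ (λ x → ¬? (x ≟ 0#)) elements-unique

  ∈-units⁺ : ∀ {x} → x ≢ 0# → x ∈ units
  ∈-units⁺ {x} = ∈-filter⁺ (λ x → ¬? (x ≟ 0#)) (∈-elements x)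

  ∈-units⁻ : ∀ {x} → x ∈ units → x ≢ 0#
  ∈-units⁻ = proj₂ ∘ ∈-filter⁻ (λ x → ¬? (x ≟ 0#))

  elements↭0∷units : elements ↭ 0# ∷ units
  elements↭0∷units = unique∧set⇒↭ elements-unique
    (All.tabulate (λ z∈units 0≡z → ∈-units⁻ z∈units (sym 0≡z)) ∷ units-unique)
    (λ {z} _ → zero-or-unit z)
    (λ {z} _ → ∈-elements z)
    where
    zero-or-unit : ∀ z → z ∈ 0# ∷ units
    zero-or-unit z with z ≟ 0#
    ... | yes z≡0 = here z≡0
    ... | no  z≢0 = there (∈-units⁺ z≢0)

  length-units : length units ≡ m
  length-units = ℕₚ.suc-injective (trans (sym (↭-length elements↭0∷units)) (length-tabulate to))

  units↭x*units : ∀ {x} → x ≢ 0# → units ↭ map (x *_) units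
  units↭x*units {x} x≢0 =
    unique∧set⇒↭ units-unique (Unique.map⁺ (*-cancelˡ x≢0) units-unique) ⊆ ⊇
    where
    ⊆ : ∀ {z} → z ∈ units → z ∈ map (x *_) units
    ⊆ {z} z∈units with quotient x≢0 z
    ... | y , z≡yx = subst (_∈ map (x *_) units) (trans (*-comm x y) (sym z≡yx))
                       (∈-map⁺ (x *_) (∈-units⁺ (quotient-nonZero (∈-units⁻ z∈units) z≡yx)))
    ⊇ : ∀ {z} → z ∈ map (x *_) units → z ∈ units
    ⊇ z∈x*units with ∈-map⁻ (x *_) z∈x*units
    ... | y , y∈units , refl = ∈-units⁺ (*-nonZero x≢0 (∈-units⁻ y∈units))

  elements↭x+elements : ∀ x → elements ↭ map (x +_) elements
  elements↭x+elements x =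
    unique∧set⇒↭ elements-unique (Unique.map⁺ (+-cancelˡ x _ _) elements-unique)
      (λ {z} _ → subst (_∈ map (x +_) elements) (x+[-x+z]≡z z) (∈-map⁺ (x +_) (∈-elements (- x + z))))
      (λ {z} _ → ∈-elements z)
    where
    x+[-x+z]≡z : ∀ z → x + (- x + z) ≡ z
    x+[-x+z]≡z z = trans (sym (+-assoc x (- x) z)) (trans (cong (_+ z) (-‿inverseʳ x)) (+-identityˡ z))

  fermat : ∀ {x} → x ≢ 0# → x ^ m ≡ 1#
  fermat {x} x≢0 = subst (λ n → x ^ n ≡ 1#) length-units
    (*-cancelʳ (product-nonZero (All.tabulate ∈-units⁻))
      (trans (foldr-translation-invariant *-commutativeMonoid (units↭x*units x≢0)) (sym (*-identityˡ _))))
    where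
    product-nonZero : ∀ {xs} → All (_≢ 0#) xs → foldr _*_ 1# xs ≢ 0#
    product-nonZero []           = 1≢0
    product-nonZero (y≢0 ∷ ys≢0) = *-nonZero y≢0 (product-nonZero ys≢0)

  [1+m]·x≡0 : ∀ x → suc m · x ≡ 0#
  [1+m]·x≡0 x = subst (λ n → n · x ≡ 0#) (length-tabulate to)
    (+-identityˡ-unique _ _ (foldr-translation-invariant +-commutativeMonoid (elements↭x+elements x)))

  -- If u had no (1+d)-th root, the (1+d)-th powers of the m = (1+d)(1+e) units would lie among
  -- the at most e roots of x^(1+e) = 1 other than u, each taken at most 1+d times.
  power-surjective : ∀ d e → suc d ℕ.* suc e ≡ m → ∀ {u} → u ^ suc e ≡ 1# →
                     Σ Carrier λ r → r ≢ 0# × r ^ suc d ≡ u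
  power-surjective d e de≡m {u} u^e≡1 with any? (λ r → r ^ suc d ≟ u) units
  ... | yes hit = let r , r∈units , r^d≡u = find hit in r , ∈-units⁻ r∈units , r^d≡u
  ... | no miss = ⊥-elim (ℕₚ.<-irrefl refl m<m)
    where
    roots others : List Carrier
    roots  = filter (λ y → y ^ suc e ≟ 1#) elements
    others = filter (λ y → ¬? (y ≟ u)) roots

    length-others : length others ≤ e
    length-others = ℕₚ.≤-pred (ℕₚ.≤-trans
      (filter-notAll (λ y → ¬? (y ≟ u)) roots (Any.map (λ u≡y y≢u → y≢u (sym u≡y)) u∈roots))
      (^≡-solutions-length≤ e 1# (Unique.filter⁺ (λ y → y ^ suc e ≟ 1#) elements-unique)
                                 (all-filter (λ y → y ^ suc e ≟ 1#) elements)))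
      where
      u∈roots : u ∈ roots
      u∈roots = ∈-filter⁺ (λ y → y ^ suc e ≟ 1#) (∈-elements u) u^e≡1

    units↦others : All (λ r → r ^ suc d ∈ others) units
    units↦others = All.tabulate λ {r} r∈units →
      ∈-filter⁺ (λ y → ¬? (y ≟ u))
        (∈-filter⁺ (λ y → y ^ suc e ≟ 1#) (∈-elements (r ^ suc d))
          (trans (^-assocʳ r (suc d) (suc e)) (trans (cong (r ^_) de≡m) (fermat (∈-units⁻ r∈units)))))
        (All.lookup (¬Any⇒All¬ units miss) r∈units)

    m<m : m < m
    m<m = begin-strict
      m                       ≡⟨ length-units ⟨
      length units            ≤⟨ pigeonhole _≟_ (_^ suc d) (suc d) (λ b → ^≡-solutions-length≤ d b)
                                            others units-unique units↦others ⟩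
      length others ℕ.* suc d ≤⟨ ℕₚ.*-monoˡ-≤ (suc d) length-others ⟩
      e ℕ.* suc d             <⟨ ℕₚ.m<n+m (e ℕ.* suc d) (s≤s z≤n) ⟩
      suc e ℕ.* suc d         ≡⟨ ℕₚ.*-comm (suc e) (suc d) ⟩
      suc d ℕ.* suc e         ≡⟨ de≡m ⟩
      m                       ∎
      where open ℕₚ.≤-Reasoning

prime∣^⇒∣ : ∀ {p m} n → Prime p → p ∣ m ℕ.^ n → p ∣ m
prime∣^⇒∣ zero    p-prime p∣1 = ⊥-elim (¬prime[1] (subst Prime (∣1⇒≡1 p∣1) p-prime))
prime∣^⇒∣ {m = m} (suc n) p-prime p∣m*m^n with euclidsLemma m (m ℕ.^ n) p-prime p∣m*m^n
... | inj₁ p∣m   = p∣m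
... | inj₂ p∣m^n = prime∣^⇒∣ n p-prime p∣m^n

IsPrimePower⇒2≤ : ∀ {q} → IsPrimePower q → 2 ℕ.≤ q
IsPrimePower⇒2≤ (0 , _ , 0-prime , _) = ⊥-elim (¬prime[0] 0-prime)
IsPrimePower⇒2≤ (1 , _ , 1-prime , _) = ⊥-elim (¬prime[1] 1-prime)
IsPrimePower⇒2≤ (p@(suc (suc _)) , suc k , _ , _ , refl) = ℕₚ.≤-trans (ℕₚ.m≤m+n 2 _) (ℕₚ.m≤m*n p (p ℕ.^ k))
  where
  instance
    p^k≢0 : ℕ.NonZero (p ℕ.^ k)
    p^k≢0 = ℕₚ.m^n≢0 p k

-- The power function of Defs is a separate definition inside FieldGeometry F q (for every q),
-- so the library's laws for _^_ are transferred to it.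
module Powers (F : Fld) (q : ℕ) where
  open FieldProperties F hiding (_^_; ^-homo-*; ^-assocʳ; ^-distrib-*; ^-nonZero)
  private module ᴸ = FieldProperties F
  open FieldGeometry F q using (_^_)

  ^≡^ᴸ : ∀ x n → x ^ n ≡ x ᴸ.^ n
  ^≡^ᴸ x zero    = refl
  ^≡^ᴸ x (suc n) = cong (x *_) (^≡^ᴸ x n)

  ^-homo-* : ∀ x m n → x ^ (m ℕ.+ n) ≡ x ^ m * x ^ n
  ^-homo-* x m n =
    trans (^≡^ᴸ x (m ℕ.+ n)) (trans (ᴸ.^-homo-* x m n) (sym (cong₂ _*_ (^≡^ᴸ x m) (^≡^ᴸ x n))))

  ^-assocʳ : ∀ x m n → (x ^ m) ^ n ≡ x ^ (m ℕ.* n)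
  ^-assocʳ x m n =
    trans (^≡^ᴸ (x ^ m) n) (trans (cong (ᴸ._^ n) (^≡^ᴸ x m)) (trans (ᴸ.^-assocʳ x m n) (sym (^≡^ᴸ x (m ℕ.* n)))))

  ^-distrib-* : ∀ x y n → (x * y) ^ n ≡ x ^ n * y ^ n
  ^-distrib-* x y n =
    trans (^≡^ᴸ (x * y) n) (trans (ᴸ.^-distrib-* x y n) (sym (cong₂ _*_ (^≡^ᴸ x n) (^≡^ᴸ y n))))

  ^-nonZero : ∀ {x} n → x ≢ 0# → x ^ n ≢ 0#
  ^-nonZero {x} n x≢0 = ᴸ.^-nonZero n x≢0 ∘ trans (sym (^≡^ᴸ x n))

  1^n≡1 : ∀ n → 1# ^ n ≡ 1#
  1^n≡1 zero    = refl
  1^n≡1 (suc n) = trans (*-identityˡ _) (1^n≡1 n)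

-- Writing q = 2 + q₂ builds in q ≥ 2 and makes q₁ = q - 1 a successor; e is the exponent of N.
module Exponents (q₂ : ℕ) where
  open +-*-Solver

  q₁ q e : ℕ
  q₁ = suc q₂
  q  = suc q₁
  e  = q ℕ.* q ℕ.+ q ℕ.+ 1

  q³≡1+q₁e : q ℕ.^ 3 ≡ suc (q₁ ℕ.* e)
  q³≡1+q₁e = solve 1 (λ n → (con 2 :+ n) :^ 3
                         := con 1 :+ (con 1 :+ n) :* ((con 2 :+ n) :* (con 2 :+ n) :+ (con 2 :+ n) :+ con 1)) refl q₂

  e≡1+q²+q : e ≡ suc (q ℕ.* q ℕ.+ q)
  e≡1+q²+q = ℕₚ.+-comm (q ℕ.* q ℕ.+ q) 1

  [q+1]+q₁[q+1]≡[q+1]q : (q ℕ.+ 1) ℕ.+ q₁ ℕ.* (q ℕ.+ 1) ≡ (q ℕ.+ 1) ℕ.* q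
  [q+1]+q₁[q+1]≡[q+1]q = solve 1 (λ n → (con 2 :+ n :+ con 1) :+ (con 1 :+ n) :* (con 2 :+ n :+ con 1)
                                     := (con 2 :+ n :+ con 1) :* (con 2 :+ n)) refl q₂

  [q+1]q²+q₁≡[q+1]q+q₁e : (q ℕ.+ 1) ℕ.* (q ℕ.* q) ℕ.+ q₁ ≡ (q ℕ.+ 1) ℕ.* q ℕ.+ q₁ ℕ.* e
  [q+1]q²+q₁≡[q+1]q+q₁e = solve 1 (λ n → (con 2 :+ n :+ con 1) :* ((con 2 :+ n) :* (con 2 :+ n)) :+ (con 1 :+ n)
      := (con 2 :+ n :+ con 1) :* (con 2 :+ n)
         :+ (con 1 :+ n) :* ((con 2 :+ n) :* (con 2 :+ n) :+ (con 2 :+ n) :+ con 1)) refl q₂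

module CubicExtension (F : Fld) (q₂ : ℕ) (enumeration : Fin (suc (suc q₂) ℕ.^ 3) ↔ Fld.Carrier F) where
  open Exponents q₂
  open FieldProperties F hiding (_^_; ^-homo-*; ^-assocʳ; ^-distrib-*; ^-nonZero)
  open FieldGeometry F q
  open Powers F q
  open ≡-Reasoning

  private module 𝔽 = FiniteField F (subst (λ n → Fin n ↔ Carrier) q³≡1+q₁e enumeration)
  open 𝔽 public using (_≟_)

  fermat : ∀ {x} → x ≢ 0# → x ^ (q₁ ℕ.* e) ≡ 1#
  fermat {x} x≢0 = trans (^≡^ᴸ x (q₁ ℕ.* e)) (𝔽.fermat x≢0)

  inFq⇒^q₁≡1 : ∀ {b} → b ≢ 0# → InFq b → b ^ q₁ ≡ 1#
  inFq⇒^q₁≡1 {b} b≢0 b^q≡b = *-cancelˡ b≢0 (trans b^q≡b (sym (*-identityʳ b)))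

  inFq-^ : ∀ {a} n → InFq a → InFq (a ^ n)
  inFq-^ {a} n a^q≡a = begin
    (a ^ n) ^ q   ≡⟨ ^-assocʳ a n q ⟩
    a ^ (n ℕ.* q) ≡⟨ cong (a ^_) (ℕₚ.*-comm n q) ⟩
    a ^ (q ℕ.* n) ≡⟨ ^-assocʳ a q n ⟨
    (a ^ q) ^ n   ≡⟨ cong (_^ n) a^q≡a ⟩
    a ^ n         ∎

  inFq-* : ∀ {a b} → InFq a → InFq b → InFq (a * b)
  inFq-* {a} {b} a^q≡a b^q≡b = trans (^-distrib-* a b q) (cong₂ _*_ a^q≡a b^q≡b)

  N-* : ∀ x y → N (x * y) ≡ N x * N y
  N-* x y = ^-distrib-* x y e

  N-^ : ∀ x n → N (x ^ n) ≡ N x ^ n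
  N-^ x n = trans (^-assocʳ x n e) (trans (cong (x ^_) (ℕₚ.*-comm n e)) (sym (^-assocʳ x e n)))

  N-1 : N 1# ≡ 1#
  N-1 = 1^n≡1 e

  N-nonZero : ∀ {x} → x ≢ 0# → N x ≢ 0#
  N-nonZero = ^-nonZero e

  N-inFq : ∀ {x} → x ≢ 0# → InFq (N x)
  N-inFq {x} x≢0 = begin
    N x ^ q                ≡⟨ ^-assocʳ x e q ⟩
    x ^ (e ℕ.* q)          ≡⟨ cong (x ^_) (ℕₚ.*-suc e q₁) ⟩
    x ^ (e ℕ.+ e ℕ.* q₁)   ≡⟨ ^-homo-* x e (e ℕ.* q₁) ⟩
    N x * x ^ (e ℕ.* q₁)   ≡⟨ cong (λ n → N x * x ^ n) (ℕₚ.*-comm e q₁) ⟩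
    N x * x ^ (q₁ ℕ.* e)   ≡⟨ cong (N x *_) (fermat x≢0) ⟩
    N x * 1#               ≡⟨ *-identityʳ (N x) ⟩
    N x                    ∎

  N-^q : ∀ {x} → x ≢ 0# → N (x ^ q) ≡ N x
  N-^q {x} x≢0 = trans (N-^ x q) (N-inFq x≢0)

  N-^q² : ∀ {x} → x ≢ 0# → N (x ^ (q ℕ.* q)) ≡ N x
  N-^q² {x} x≢0 = begin
    N (x ^ (q ℕ.* q)) ≡⟨ N-^ x (q ℕ.* q) ⟩
    N x ^ (q ℕ.* q)   ≡⟨ ^-assocʳ (N x) q q ⟨
    (N x ^ q) ^ q     ≡⟨ cong (_^ q) (N-inFq x≢0) ⟩
    N x ^ q           ≡⟨ N-inFq x≢0 ⟩
    N x               ∎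

  N-^q₁ : ∀ {x} → x ≢ 0# → N (x ^ q₁) ≡ 1#
  N-^q₁ {x} x≢0 = trans (N-^ x q₁) (inFq⇒^q₁≡1 (N-nonZero x≢0) (N-inFq x≢0))

  N-^[q+1] : ∀ {x} → x ≢ 0# → N (x ^ (q ℕ.+ 1)) ≡ N x * N x
  N-^[q+1] {x} x≢0 = begin
    N (x ^ (q ℕ.+ 1))   ≡⟨ N-^ x (q ℕ.+ 1) ⟩
    N x ^ (q ℕ.+ 1)     ≡⟨ ^-homo-* (N x) q 1 ⟩
    N x ^ q * N x ^ 1   ≡⟨ cong₂ _*_ (N-inFq x≢0) (*-identityʳ (N x)) ⟩
    N x * N x           ∎

  norm-surjective : ∀ {b} → b ≢ 0# → InFq b → Σ Carrier λ k → k ≢ 0# × N k ≡ b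
  norm-surjective {b} b≢0 b∈Fq =
    let k , k≢0 , k^e≡b = 𝔽.power-surjective (q ℕ.* q ℕ.+ q) q₂
                             (trans (cong (ℕ._* q₁) (sym e≡1+q²+q)) (ℕₚ.*-comm e q₁))
                             (trans (sym (^≡^ᴸ b q₁)) (inFq⇒^q₁≡1 b≢0 b∈Fq))
    in k , k≢0 , trans (cong (k ^_) e≡1+q²+q) (trans (^≡^ᴸ k (suc (q ℕ.* q ℕ.+ q))) k^e≡b)

  hilbert90 : ∀ {u} → N u ≡ 1# → Σ Carrier λ v → v ≢ 0# × v ^ q₁ ≡ u
  hilbert90 {u} Nu≡1 =
    let v , v≢0 , v^q₁≡u = 𝔽.power-surjective q₂ (q ℕ.* q ℕ.+ q) (cong (q₁ ℕ.*_) (sym e≡1+q²+q))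
                             (trans (sym (^≡^ᴸ u (suc (q ℕ.* q ℕ.+ q)))) (trans (cong (u ^_) (sym e≡1+q²+q)) Nu≡1))
    in v , v≢0 , trans (^≡^ᴸ v q₁) v^q₁≡u

  N≡N⇒quotient-power : ∀ {κ κ'} → κ ≢ 0# → N κ ≡ N κ' → Σ Carrier λ v → v ≢ 0# × κ' ≡ κ * v ^ q₁
  N≡N⇒quotient-power {κ} {κ'} κ≢0 Nκ≡Nκ' =
    let v , v≢0 , v^q₁≡u = hilbert90 Nu≡1
    in v , v≢0 , trans κ'≡uκ (trans (*-comm u κ) (cong (κ *_) (sym v^q₁≡u)))
    where
    u : Carrier
    u = proj₁ (quotient κ≢0 κ')
    κ'≡uκ : κ' ≡ u * κ
    κ'≡uκ = proj₂ (quotient κ≢0 κ')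
    Nu≡1 : N u ≡ 1#
    Nu≡1 = *-cancelʳ (N-nonZero κ≢0) (begin
      N u * N κ  ≡⟨ N-* u κ ⟨
      N (u * κ)  ≡⟨ cong N κ'≡uκ ⟨
      N κ'       ≡⟨ Nκ≡Nκ' ⟨
      N κ        ≡⟨ *-identityˡ (N κ) ⟨
      1# * N κ   ∎)

  q·1≡0 : q · 1# ≡ 0#
  q·1≡0 = ^≡0⇒≡0 _≟_ 3 (trans (sym (·1-homo-^ q 3)) (trans (cong (_· 1#) q³≡1+q₁e) (𝔽.[1+m]·x≡0 1#)))

  odd⇒q≡1+[q/2]*2 : q % 2 ≡ 1 → q ≡ suc (q / 2 ℕ.* 2)
  odd⇒q≡1+[q/2]*2 q-odd = trans (m≡m%n+[m/n]*n q 2) (cong (ℕ._+ q / 2 ℕ.* 2) q-odd)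

  odd⇒1+1≢0 : q % 2 ≡ 1 → 1# + 1# ≢ 0#
  odd⇒1+1≢0 q-odd 1+1≡0 = 1≢0 (begin
    1#                         ≡⟨ +-identityʳ 1# ⟨
    1# + 0#                    ≡⟨ cong (1# +_) [q/2]*2·1≡0 ⟨
    1# + (q / 2 ℕ.* 2) · 1#    ≡⟨ cong (_· 1#) (odd⇒q≡1+[q/2]*2 q-odd) ⟨
    q · 1#                     ≡⟨ q·1≡0 ⟩
    0#                         ∎)
    where
    [q/2]*2·1≡0 : (q / 2 ℕ.* 2) · 1# ≡ 0#
    [q/2]*2·1≡0 = begin
      (q / 2 ℕ.* 2) · 1#       ≡⟨ ×1-homo-* (q / 2) 2 ⟩
      (q / 2) · 1# * (1# + (1# + 0#)) ≡⟨ cong (λ a → (q / 2) · 1# * (1# + a)) (+-identityʳ 1#) ⟩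
      (q / 2) · 1# * (1# + 1#) ≡⟨ cong ((q / 2) · 1# *_) 1+1≡0 ⟩
      (q / 2) · 1# * 0#        ≡⟨ zeroʳ _ ⟩
      0#                       ∎

  even⇒1+1≡0 : IsPrimePower q → q % 2 ≡ 0 → 1# + 1# ≡ 0#
  even⇒1+1≡0 (p , k , p-prime , _ , q≡p^k) q-even = begin
    1# + 1#          ≡⟨ cong (1# +_) (+-identityʳ 1#) ⟨
    2 · 1#           ≡⟨ cong (_· 1#) p≡2 ⟨
    p · 1#           ≡⟨ ^≡0⇒≡0 _≟_ k (trans (sym (·1-homo-^ p k)) (trans (cong (_· 1#) (sym q≡p^k)) q·1≡0)) ⟩
    0#               ∎
    where
    p≡2 : p ≡ 2
    p≡2 with prime⇒irreducible p-prime (prime∣^⇒∣ k prime[2] (subst (2 ∣_) q≡p^k (m%n≡0⇒n∣m q 2 q-even)))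
    ... | inj₂ 2≡p = sym 2≡p

  -1∈Fq : q % 2 ≡ 1 → InFq (- 1#)
  -1∈Fq q-odd = begin
    (- 1#) ^ q                              ≡⟨ cong ((- 1#) ^_) (odd⇒q≡1+[q/2]*2 q-odd) ⟩
    - 1# * (- 1#) ^ (q / 2 ℕ.* 2)           ≡⟨ cong (λ n → - 1# * (- 1#) ^ n) (ℕₚ.*-comm (q / 2) 2) ⟩
    - 1# * (- 1#) ^ (2 ℕ.* (q / 2))         ≡⟨ cong (- 1# *_) (^-assocʳ (- 1#) 2 (q / 2)) ⟨
    - 1# * ((- 1#) ^ 2) ^ (q / 2)           ≡⟨ cong (λ a → - 1# * a ^ (q / 2)) [-1]²≡1 ⟩
    - 1# * 1# ^ (q / 2)                     ≡⟨ cong (- 1# *_) (1^n≡1 (q / 2)) ⟩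
    - 1# * 1#                               ≡⟨ *-identityʳ (- 1#) ⟩
    - 1#                                    ∎
    where
    [-1]²≡1 : (- 1#) ^ 2 ≡ 1#
    [-1]²≡1 = trans (cong (- 1# *_) (*-identityʳ (- 1#))) (trans (-x*-y≡x*y 1# 1#) (*-identityʳ 1#))

  inFq-neg : q % 2 ≡ 1 → ∀ {b} → InFq b → InFq (- b)
  inFq-neg q-odd {b} b∈Fq = subst InFq (-1*x≈-x b) (inFq-* (-1∈Fq q-odd) b∈Fq)

  even⇒half-power² : q % 2 ≡ 0 → ∀ {a} → InFq a → a ^ (q / 2) * a ^ (q / 2) ≡ a
  even⇒half-power² q-even {a} a^q≡a = begin
    a ^ (q / 2) * a ^ (q / 2)          ≡⟨ cong (a ^ (q / 2) *_) (*-identityʳ _) ⟨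
    (a ^ (q / 2)) ^ 2                  ≡⟨ ^-assocʳ a (q / 2) 2 ⟩
    a ^ (q / 2 ℕ.* 2)                  ≡⟨ cong (a ^_) q≡[q/2]*2 ⟨
    a ^ q                              ≡⟨ a^q≡a ⟩
    a                                  ∎
    where
    q≡[q/2]*2 : q ≡ q / 2 ℕ.* 2
    q≡[q/2]*2 = trans (m≡m%n+[m/n]*n q 2) (cong (ℕ._+ q / 2 ℕ.* 2) q-even)

module PencilsAndPlanes (F : Fld) (q₂ : ℕ) (enumeration : Fin (suc (suc q₂) ℕ.^ 3) ↔ Fld.Carrier F) where
  open Exponents q₂
  open FieldProperties F hiding (_^_; ^-homo-*; ^-assocʳ; ^-distrib-*; ^-nonZero)
  open import Algebra.Solver.Ring.NaturalCoefficients.Default commutativeSemiring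
    using (solve; _:=_; _:+_; _:*_; con)
  open FieldGeometry F q
  open Powers F q
  open CubicExtension F q₂ enumeration
  open ≡-Reasoning

  ≡-triple : ∀ {a b c a' b' c'} → a ≡ a' → b ≡ b' → c ≡ c' → _≡_ {A = Triple} (a , b , c) (a' , b' , c')
  ≡-triple a≡a' b≡b' c≡c' = cong₂ _,_ a≡a' (cong₂ _,_ b≡b' c≡c')

  scale-scale : ∀ a b X → scale a (scale b X) ≡ scale (a * b) X
  scale-scale a b (x , y , z) = ≡-triple (sym (*-assoc a b x)) (sym (*-assoc a b y)) (sym (*-assoc a b z))

  scale-1 : ∀ X → scale 1# X ≡ X
  scale-1 (x , y , z) = ≡-triple (*-identityˡ x) (*-identityˡ y) (*-identityˡ z)

  ProjEq-rescale : ∀ {P X Y c} → ProjEq P X → Y ≡ scale c X → c ≢ 0# → ProjEq P Y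
  ProjEq-rescale {P} {X} {Y} {c} (l , l≢0 , P≡lX) Y≡cX c≢0 =
    l * c⁻¹ , *-nonZero l≢0 (quotient-nonZero 1≢0 1≡c⁻¹c) , (begin
    P                        ≡⟨ P≡lX ⟩
    scale l X                ≡⟨ cong (scale l) (scale-1 X) ⟨
    scale l (scale 1# X)     ≡⟨ cong (λ a → scale l (scale a X)) 1≡c⁻¹c ⟩
    scale l (scale (c⁻¹ * c) X)  ≡⟨ cong (scale l) (scale-scale c⁻¹ c X) ⟨
    scale l (scale c⁻¹ (scale c X)) ≡⟨ cong (scale l ∘ scale c⁻¹) Y≡cX ⟨
    scale l (scale c⁻¹ Y)    ≡⟨ scale-scale l c⁻¹ Y ⟩
    scale (l * c⁻¹) Y        ∎)
    where
    c⁻¹ : Carrier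
    c⁻¹ = proj₁ (quotient c≢0 1#)
    1≡c⁻¹c : 1# ≡ c⁻¹ * c
    1≡c⁻¹c = proj₂ (quotient c≢0 1#)

  Ppt-scale : ∀ κ r {l} → l ^ q ≡ l → Ppt κ (l * r) ≡ scale l (Ppt κ r)
  Ppt-scale κ r {l} l^q≡l = ≡-triple (*-assoc l r _) (trans (^-distrib-* l r q) (cong (_* r ^ q) l^q≡l)) (begin
    (l * r) ^ (q ℕ.* q) * κ          ≡⟨ cong (_* κ) (^-distrib-* l r (q ℕ.* q)) ⟩
    l ^ (q ℕ.* q) * r ^ (q ℕ.* q) * κ ≡⟨ cong (λ a → a * r ^ (q ℕ.* q) * κ) l^q²≡l ⟩
    l * r ^ (q ℕ.* q) * κ            ≡⟨ *-assoc l _ κ ⟩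
    l * (r ^ (q ℕ.* q) * κ)          ∎)
    where
    l^q²≡l : l ^ (q ℕ.* q) ≡ l
    l^q²≡l = trans (sym (^-assocʳ l q q)) (trans (cong (_^ q) l^q≡l) l^q≡l)

  Ppt-rescale : ∀ κ r {v} → v ≢ 0# →
                Ppt (κ * v ^ q₁) (v ^ (q ℕ.+ 1) * r) ≡ scale (v ^ ((q ℕ.+ 1) ℕ.* q)) (Ppt κ r)
  Ppt-rescale κ r {v} v≢0 = ≡-triple first second third
    where
    c K μ : Carrier
    c = v ^ (q ℕ.+ 1)
    K = κ ^ (q ℕ.+ 1)
    μ = v ^ ((q ℕ.+ 1) ℕ.* q)
    first : c * r * (κ * v ^ q₁) ^ (q ℕ.+ 1) ≡ μ * (r * K)
    first = begin
      c * r * (κ * v ^ q₁) ^ (q ℕ.+ 1)                 ≡⟨ cong (c * r *_) (trans (^-distrib-* κ (v ^ q₁) (q ℕ.+ 1))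
                                                            (cong (K *_) (^-assocʳ v q₁ (q ℕ.+ 1)))) ⟩
      c * r * (K * v ^ (q₁ ℕ.* (q ℕ.+ 1)))             ≡⟨ solve 4 (λ c r K w → c :* r :* (K :* w) := c :* w :* (r :* K))
                                                                 refl c r K (v ^ (q₁ ℕ.* (q ℕ.+ 1))) ⟩
      c * v ^ (q₁ ℕ.* (q ℕ.+ 1)) * (r * K)             ≡⟨ cong (_* (r * K)) (^-homo-* v (q ℕ.+ 1) (q₁ ℕ.* (q ℕ.+ 1))) ⟨
      v ^ ((q ℕ.+ 1) ℕ.+ q₁ ℕ.* (q ℕ.+ 1)) * (r * K)   ≡⟨ cong (λ n → v ^ n * (r * K)) [q+1]+q₁[q+1]≡[q+1]q ⟩
      μ * (r * K)                                     ∎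
    second : (c * r) ^ q ≡ μ * r ^ q
    second = trans (^-distrib-* c r q) (cong (_* r ^ q) (^-assocʳ v (q ℕ.+ 1) q))
    c^q²v^q₁≡μ : c ^ (q ℕ.* q) * v ^ q₁ ≡ μ
    c^q²v^q₁≡μ = begin
      c ^ (q ℕ.* q) * v ^ q₁                             ≡⟨ cong (_* v ^ q₁) (^-assocʳ v (q ℕ.+ 1) (q ℕ.* q)) ⟩
      v ^ ((q ℕ.+ 1) ℕ.* (q ℕ.* q)) * v ^ q₁             ≡⟨ ^-homo-* v ((q ℕ.+ 1) ℕ.* (q ℕ.* q)) q₁ ⟨
      v ^ ((q ℕ.+ 1) ℕ.* (q ℕ.* q) ℕ.+ q₁)               ≡⟨ cong (v ^_) [q+1]q²+q₁≡[q+1]q+q₁e ⟩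
      v ^ ((q ℕ.+ 1) ℕ.* q ℕ.+ q₁ ℕ.* e)                 ≡⟨ ^-homo-* v ((q ℕ.+ 1) ℕ.* q) (q₁ ℕ.* e) ⟩
      μ * v ^ (q₁ ℕ.* e)                                ≡⟨ cong (μ *_) (fermat v≢0) ⟩
      μ * 1#                                            ≡⟨ *-identityʳ μ ⟩
      μ                                                 ∎
    third : (c * r) ^ (q ℕ.* q) * (κ * v ^ q₁) ≡ μ * (r ^ (q ℕ.* q) * κ)
    third = begin
      (c * r) ^ (q ℕ.* q) * (κ * v ^ q₁)                 ≡⟨ cong (_* (κ * v ^ q₁)) (^-distrib-* c r (q ℕ.* q)) ⟩
      c ^ (q ℕ.* q) * r ^ (q ℕ.* q) * (κ * v ^ q₁)       ≡⟨ solve 4 (λ a R k w → a :* R :* (k :* w) := a :* w :* (R :* k))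
                                                                 refl (c ^ (q ℕ.* q)) (r ^ (q ℕ.* q)) κ (v ^ q₁) ⟩
      c ^ (q ℕ.* q) * v ^ q₁ * (r ^ (q ℕ.* q) * κ)       ≡⟨ cong (_* (r ^ (q ℕ.* q) * κ)) c^q²v^q₁≡μ ⟩
      μ * (r ^ (q ℕ.* q) * κ)                           ∎

  pencilLine≡ : ∀ θ x → pencilLine θ x ≡ (- (x ^ q) , x * θ , 0#)
  pencilLine≡ θ x = ≡-triple
    (trans (cong₂ _+_ (zeroˡ 0#) (cong -_ (*-identityˡ _))) (+-identityˡ _))
    (trans (cong₂ _+_ (*-identityˡ _) (trans (cong -_ (zeroˡ 0#)) -0#≈0#)) (+-identityʳ _))
    (trans (cong₂ _+_ (zeroˡ _) (trans (cong -_ (zeroˡ _)) -0#≈0#)) (+-identityʳ _))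

  pencilLine-rescale : ∀ θ x {v} → pencilLine (θ * v ^ q₁) (x * v) ≡ scale (v ^ q) (pencilLine θ x)
  pencilLine-rescale θ x {v} = begin
    pencilLine (θ * v ^ q₁) (x * v)                 ≡⟨ pencilLine≡ _ _ ⟩
    (- ((x * v) ^ q) , x * v * (θ * v ^ q₁) , 0#)    ≡⟨ ≡-triple
        (trans (cong -_ (trans (^-distrib-* x v q) (*-comm _ _))) (-‿distribʳ-* (v ^ q) (x ^ q)))
        (solve 4 (λ x v θ w → x :* v :* (θ :* w) := v :* w :* (x :* θ)) refl x v θ (v ^ q₁))
        (sym (zeroʳ (v ^ q))) ⟩
    scale (v ^ q) (- (x ^ q) , x * θ , 0#)           ≡⟨ cong (scale (v ^ q)) (pencilLine≡ θ x) ⟨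
    scale (v ^ q) (pencilLine θ x)                 ∎

  Meets : Carrier → Carrier → Carrier → Carrier → Set
  Meets θ κ x r = x * θ * r ^ q ≡ x ^ q * (r * κ ^ (q ℕ.+ 1))

  incident⇔meets : ∀ θ κ x r → Incident (pencilLine θ x) (Ppt κ r) ⇔ Meets θ κ x r
  incident⇔meets θ κ x r =
    subst (λ ℓ → Incident ℓ (Ppt κ r) ⇔ Meets θ κ x r) (sym (pencilLine≡ θ x))
      (mk⇔ (x∙y⁻¹≈ε⇒x≈y _ _ ∘ trans (sym lhs≡)) (trans lhs≡ ∘ x≈y⇒x∙y⁻¹≈ε))
    where
    K : Carrier
    K = κ ^ (q ℕ.+ 1)
    lhs≡ : - (x ^ q) * (r * K) + x * θ * r ^ q + 0# * (r ^ (q ℕ.* q) * κ) ≡ x * θ * r ^ q - x ^ q * (r * K)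
    lhs≡ = begin
      - (x ^ q) * (r * K) + x * θ * r ^ q + 0# * (r ^ (q ℕ.* q) * κ) ≡⟨ cong (- (x ^ q) * (r * K) + x * θ * r ^ q +_)
                                                                              (zeroˡ (r ^ (q ℕ.* q) * κ)) ⟩
      - (x ^ q) * (r * K) + x * θ * r ^ q + 0#                      ≡⟨ +-identityʳ _ ⟩
      - (x ^ q) * (r * K) + x * θ * r ^ q                           ≡⟨ +-comm _ _ ⟩
      x * θ * r ^ q + - (x ^ q) * (r * K)                           ≡⟨ cong (x * θ * r ^ q +_) (-‿distribˡ-* _ _) ⟨
      x * θ * r ^ q - x ^ q * (r * K)                               ∎

  meets-somewhere : ∀ {θ κ x} → θ ≢ 0# → κ ≢ 0# → N κ * N κ ≡ N θ → x ≢ 0# →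
                    Σ Carrier λ r → r ≢ 0# × Meets θ κ x r
  meets-somewhere {θ} {κ} {x} θ≢0 κ≢0 NκNκ≡Nθ x≢0 =
    let v , v≢0 , v^q₁≡u = hilbert90 Nu≡1 in v , v≢0 , (begin
      x * θ * (v * v ^ q₁)                ≡⟨ cong (λ a → x * θ * (v * a)) v^q₁≡u ⟩
      x * θ * (v * u)                     ≡⟨ solve 4 (λ x θ v u → x :* θ :* (v :* u) := x :* v :* (u :* θ)) refl x θ v u ⟩
      x * v * (u * θ)                     ≡⟨ cong (x * v *_) x^q₁K≡uθ ⟨
      x * v * (x ^ q₁ * K)                ≡⟨ solve 4 (λ x v y K → x :* v :* (y :* K) := x :* y :* (v :* K))
                                                     refl x v (x ^ q₁) K ⟩
      x * x ^ q₁ * (v * K)                ∎)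
    where
    K u : Carrier
    K = κ ^ (q ℕ.+ 1)
    u = proj₁ (quotient θ≢0 (x ^ q₁ * K))
    x^q₁K≡uθ : x ^ q₁ * K ≡ u * θ
    x^q₁K≡uθ = proj₂ (quotient θ≢0 (x ^ q₁ * K))
    Nu≡1 : N u ≡ 1#
    Nu≡1 = *-cancelʳ (N-nonZero θ≢0) (begin
      N u * N θ              ≡⟨ N-* u θ ⟨
      N (u * θ)              ≡⟨ cong N x^q₁K≡uθ ⟨
      N (x ^ q₁ * K)         ≡⟨ N-* (x ^ q₁) K ⟩
      N (x ^ q₁) * N K       ≡⟨ cong₂ _*_ (N-^q₁ x≢0) (trans (N-^[q+1] κ≢0) NκNκ≡Nθ) ⟩
      1# * N θ               ∎)

  meets-proportional : ∀ {θ κ x r r'} → θ ≢ 0# → x ≢ 0# → r ≢ 0# → r' ≢ 0# →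
                       Meets θ κ x r → Meets θ κ x r' → ProjEq (Ppt κ r) (Ppt κ r')
  meets-proportional {θ} {κ} {x} {r} {r'} θ≢0 x≢0 r≢0 r'≢0 meets meets' =
    l , quotient-nonZero r≢0 r≡lr' , trans (cong (Ppt κ) r≡lr') (Ppt-scale κ r' l^q≡l)
    where
    l K : Carrier
    l = proj₁ (quotient r'≢0 r)
    r≡lr' : r ≡ l * r'
    r≡lr' = proj₂ (quotient r'≢0 r)
    K = κ ^ (q ℕ.+ 1)
    l^q≡l : l ^ q ≡ l
    l^q≡l = *-cancelʳ (*-nonZero (*-nonZero x≢0 θ≢0) (^-nonZero q r'≢0)) (begin
      l ^ q * (x * θ * r' ^ q)   ≡⟨ solve 3 (λ a b c → a :* (b :* c) := b :* (a :* c)) refl (l ^ q) (x * θ) (r' ^ q) ⟩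
      x * θ * (l ^ q * r' ^ q)   ≡⟨ cong (x * θ *_) (^-distrib-* l r' q) ⟨
      x * θ * (l * r') ^ q       ≡⟨ cong (λ a → x * θ * a ^ q) r≡lr' ⟨
      x * θ * r ^ q              ≡⟨ meets ⟩
      x ^ q * (r * K)            ≡⟨ cong (λ a → x ^ q * (a * K)) r≡lr' ⟩
      x ^ q * (l * r' * K)       ≡⟨ solve 4 (λ y l r K → y :* (l :* r :* K) := l :* (y :* (r :* K))) refl (x ^ q) l r' K ⟩
      l * (x ^ q * (r' * K))     ≡⟨ cong (l *_) meets' ⟨
      l * (x * θ * r' ^ q)       ∎)

  arches⇐ : ∀ {θ κ} → θ ≢ 0# → κ ≢ 0# → N κ * N κ ≡ N θ → Arches θ κ
  arches⇐ {θ} {κ} θ≢0 κ≢0 NκNκ≡Nθ (x , x≢0) = point , unique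
    where
    point : Σ F* λ r → Incident (pencilLine θ x) (Ppt κ (proj₁ r))
    point = let r , r≢0 , meets = meets-somewhere θ≢0 κ≢0 NκNκ≡Nθ x≢0
            in (r , r≢0) , Equivalence.from (incident⇔meets θ κ x r) meets
    unique : (r r' : F*) → Incident (pencilLine θ x) (Ppt κ (proj₁ r)) → Incident (pencilLine θ x) (Ppt κ (proj₁ r'))
           → ProjEq (Ppt κ (proj₁ r)) (Ppt κ (proj₁ r'))
    unique (r , r≢0) (r' , r'≢0) incident incident' = meets-proportional θ≢0 x≢0 r≢0 r'≢0
      (Equivalence.to (incident⇔meets θ κ x r) incident) (Equivalence.to (incident⇔meets θ κ x r') incident')

  incident-at-1 : ∀ {θ κ r} → Incident (pencilLine θ 1#) (Ppt κ r) → θ * r ^ q ≡ r * κ ^ (q ℕ.+ 1)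
  incident-at-1 {θ} {κ} {r} incident = begin
    θ * r ^ q                    ≡⟨ cong (_* r ^ q) (*-identityˡ θ) ⟨
    1# * θ * r ^ q               ≡⟨ Equivalence.to (incident⇔meets θ κ 1# r) incident ⟩
    1# ^ q * (r * κ ^ (q ℕ.+ 1)) ≡⟨ trans (cong (_* (r * κ ^ (q ℕ.+ 1))) (1^n≡1 q)) (*-identityˡ _) ⟩
    r * κ ^ (q ℕ.+ 1)            ∎

  arches⇒ : ∀ {θ κ} → κ ≢ 0# → Arches θ κ → N κ * N κ ≡ N θ
  arches⇒ {θ} {κ} κ≢0 arches =
    let (r , r≢0) , incident = proj₁ (arches (1# , 1≢0)) in *-cancelʳ (N-nonZero r≢0) (begin
      N κ * N κ * N r               ≡⟨ *-comm (N κ * N κ) (N r) ⟩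
      N r * (N κ * N κ)             ≡⟨ cong (N r *_) (N-^[q+1] κ≢0) ⟨
      N r * N (κ ^ (q ℕ.+ 1))       ≡⟨ N-* r (κ ^ (q ℕ.+ 1)) ⟨
      N (r * κ ^ (q ℕ.+ 1))         ≡⟨ cong N (incident-at-1 incident) ⟨
      N (θ * r ^ q)                 ≡⟨ N-* θ (r ^ q) ⟩
      N θ * N (r ^ q)               ≡⟨ cong (N θ *_) (N-^q r≢0) ⟩
      N θ * N r                     ∎)

  inPlane-transfer : ∀ {κ κ' P} → κ ≢ 0# → N κ ≡ N κ' → InPlane κ P → InPlane κ' P
  inPlane-transfer {κ} {κ'} κ≢0 Nκ≡Nκ' ((r , r≢0) , P∼Pκr) =
    let v , v≢0 , κ'≡κv^q₁ = N≡N⇒quotient-power κ≢0 Nκ≡Nκ'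
    in (v ^ (q ℕ.+ 1) * r , *-nonZero (^-nonZero (q ℕ.+ 1) v≢0) r≢0) ,
       ProjEq-rescale P∼Pκr (trans (cong (λ k → Ppt k (v ^ (q ℕ.+ 1) * r)) κ'≡κv^q₁) (Ppt-rescale κ r v≢0))
                      (^-nonZero ((q ℕ.+ 1) ℕ.* q) v≢0)

  N≡N⇒samePlane : ∀ {κ κ'} → κ ≢ 0# → κ' ≢ 0# → N κ ≡ N κ' → SamePlane κ κ'
  N≡N⇒samePlane κ≢0 κ'≢0 Nκ≡Nκ' P = inPlane-transfer κ≢0 Nκ≡Nκ' , inPlane-transfer κ'≢0 (sym Nκ≡Nκ')

  Ppt1≡scaled⇒N≡N : ∀ {κ κ' l r} → r ≢ 0# → Ppt κ 1# ≡ scale l (Ppt κ' r) → N κ ≡ N κ'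
  Ppt1≡scaled⇒N≡N {κ} {κ'} {l} {r} r≢0 Pκ1≡lPκ'r = begin
    N κ                                   ≡⟨ cong N (trans (cong (_* κ) (1^n≡1 (q ℕ.* q))) (*-identityˡ κ)) ⟨
    N (1# ^ (q ℕ.* q) * κ)                ≡⟨ cong (N ∘ proj₂ ∘ proj₂) Pκ1≡lPκ'r ⟩
    N (l * (r ^ (q ℕ.* q) * κ'))          ≡⟨ trans (N-* l (r ^ (q ℕ.* q) * κ')) (cong (N l *_) (N-* (r ^ (q ℕ.* q)) κ')) ⟩
    N l * (N (r ^ (q ℕ.* q)) * N κ')      ≡⟨ cong (λ a → N l * (a * N κ')) (N-^q² r≢0) ⟩
    N l * (N r * N κ')                    ≡⟨ *-assoc (N l) (N r) (N κ') ⟨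
    N l * N r * N κ'                      ≡⟨ cong (_* N κ') NlNr≡1 ⟩
    1# * N κ'                             ≡⟨ *-identityˡ (N κ') ⟩
    N κ'                                  ∎
    where
    NlNr≡1 : N l * N r ≡ 1#
    NlNr≡1 = begin
      N l * N r             ≡⟨ cong (N l *_) (N-^q r≢0) ⟨
      N l * N (r ^ q)       ≡⟨ N-* l (r ^ q) ⟨
      N (l * r ^ q)         ≡⟨ cong (N ∘ proj₁ ∘ proj₂) Pκ1≡lPκ'r ⟨
      N (1# ^ q)            ≡⟨ cong N (1^n≡1 q) ⟩
      N 1#                  ≡⟨ N-1 ⟩
      1#                    ∎

  samePlane⇒N≡N : ∀ {κ κ'} → SamePlane κ κ' → N κ ≡ N κ'
  samePlane⇒N≡N {κ} same =
    let (r , r≢0) , _ , _ , Pκ1≡lPκ'r = proj₁ (same (Ppt κ 1#)) ((1# , 1≢0) , 1# , 1≢0 , sym (scale-1 (Ppt κ 1#)))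
    in Ppt1≡scaled⇒N≡N r≢0 Pκ1≡lPκ'r

  inPencil-transfer : ∀ {θ θ' ℓ} → θ ≢ 0# → N θ ≡ N θ' → InPencil θ ℓ → InPencil θ' ℓ
  inPencil-transfer {θ} {θ'} θ≢0 Nθ≡Nθ' ((x , x≢0) , ℓ∼TXx) =
    let v , v≢0 , θ'≡θv^q₁ = N≡N⇒quotient-power θ≢0 Nθ≡Nθ'
    in (x * v , *-nonZero x≢0 v≢0) ,
       ProjEq-rescale ℓ∼TXx (trans (cong (λ t → pencilLine t (x * v)) θ'≡θv^q₁) (pencilLine-rescale θ x))
                      (^-nonZero q v≢0)

  N≡N⇒samePencil : ∀ {θ θ'} → θ ≢ 0# → θ' ≢ 0# → N θ ≡ N θ' → SamePencil θ θ'
  N≡N⇒samePencil θ≢0 θ'≢0 Nθ≡Nθ' ℓ = inPencil-transfer θ≢0 Nθ≡Nθ' , inPencil-transfer θ'≢0 (sym Nθ≡Nθ')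

  same-plane⇒same-pencil : (θ θ' κ : F*) → Arches (proj₁ θ) (proj₁ κ) → Arches (proj₁ θ') (proj₁ κ) →
                           SamePencil (proj₁ θ) (proj₁ θ')
  same-plane⇒same-pencil (θ , θ≢0) (θ' , θ'≢0) (κ , κ≢0) arches arches' =
    N≡N⇒samePencil θ≢0 θ'≢0 (trans (sym (arches⇒ κ≢0 arches)) (arches⇒ κ≢0 arches'))

  nonsquare⇒no-plane : (θ : F*) → ¬ NonzeroSquareInFq (N (proj₁ θ)) → (κ : F*) → ¬ Arches (proj₁ θ) (proj₁ κ)
  nonsquare⇒no-plane (θ , θ≢0) nonsquare (κ , κ≢0) arches =
    nonsquare (N-nonZero θ≢0 , N-inFq θ≢0 , N κ , N-inFq κ≢0 , arches⇒ κ≢0 arches)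

  even⇒unique-plane : IsPrimePower q → q % 2 ≡ 0 → (θ : F*) →
    Σ F* λ κ → Arches (proj₁ θ) (proj₁ κ)
             × ((κ' : F*) → Arches (proj₁ θ) (proj₁ κ') → SamePlane (proj₁ κ') (proj₁ κ))
  even⇒unique-plane q-pp q-even (θ , θ≢0) =
    let κ , κ≢0 , Nκ≡b = norm-surjective (^-nonZero (q / 2) (N-nonZero θ≢0)) (inFq-^ (q / 2) (N-inFq θ≢0))
        NκNκ≡Nθ = trans (cong₂ _*_ Nκ≡b Nκ≡b) (even⇒half-power² q-even (N-inFq θ≢0))
    in (κ , κ≢0) , arches⇐ θ≢0 κ≢0 NκNκ≡Nθ , λ (κ' , κ'≢0) arches' →
       N≡N⇒samePlane κ'≢0 κ≢0 (square-injective (trans (arches⇒ κ'≢0 arches') (sym NκNκ≡Nθ)))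
    where
    square-injective : ∀ {x y} → x * x ≡ y * y → x ≡ y
    square-injective xx≡yy =
      [ id , (λ x≡-y → trans x≡-y (1+1≡0⇒-x≡x (even⇒1+1≡0 q-pp q-even) _)) ]′
        (square≡square⇒≡± _≟_ xx≡yy)

  odd⇒two-planes : q % 2 ≡ 1 → (θ : F*) → NonzeroSquareInFq (N (proj₁ θ)) →
    Σ F* λ κ₁ → Σ F* λ κ₂ → ¬ SamePlane (proj₁ κ₁) (proj₁ κ₂)
      × Arches (proj₁ θ) (proj₁ κ₁) × Arches (proj₁ θ) (proj₁ κ₂)
      × ((κ : F*) → Arches (proj₁ θ) (proj₁ κ)
           → SamePlane (proj₁ κ) (proj₁ κ₁) ⊎ SamePlane (proj₁ κ) (proj₁ κ₂))
  odd⇒two-planes q-odd (θ , θ≢0) (_ , _ , b , b∈Fq , bb≡Nθ) =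
    let κ₁ , κ₁≢0 , Nκ₁≡b  = norm-surjective b≢0 b∈Fq
        κ₂ , κ₂≢0 , Nκ₂≡-b = norm-surjective (-‿nonZero b≢0) (inFq-neg q-odd b∈Fq)
    in (κ₁ , κ₁≢0) , (κ₂ , κ₂≢0)
       , (λ same → 1+1≢0⇒x≢-x (odd⇒1+1≢0 q-odd) b≢0
                     (trans (sym Nκ₁≡b) (trans (samePlane⇒N≡N same) Nκ₂≡-b)))
       , arches⇐ θ≢0 κ₁≢0 (trans (cong₂ _*_ Nκ₁≡b Nκ₁≡b) bb≡Nθ)
       , arches⇐ θ≢0 κ₂≢0 (trans (cong₂ _*_ Nκ₂≡-b Nκ₂≡-b) (trans (-x*-y≡x*y b b) bb≡Nθ))
       , λ (κ , κ≢0) arches →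
           Sum.map (λ Nκ≡b  → N≡N⇒samePlane κ≢0 κ₁≢0 (trans Nκ≡b (sym Nκ₁≡b)))
                   (λ Nκ≡-b → N≡N⇒samePlane κ≢0 κ₂≢0 (trans Nκ≡-b (sym Nκ₂≡-b)))
                   (square≡square⇒≡± _≟_ (trans (arches⇒ κ≢0 arches) (sym bb≡Nθ)))
    where
    b≢0 : b ≢ 0#
    b≢0 = square-nonZero⇒nonZero (N-nonZero θ≢0 ∘ trans (sym bb≡Nθ))

open import Data.Nat using (_^_)

corollary6p2 : (q : ℕ) → IsPrimePower q → (F : Fld) → (Fin (q ^ 3) ↔ Fld.Carrier F) →
  let open FieldGeometry F q in
    (q % 2 ≡ 0 →
        ((θ : F*) → Σ F* λ κ → Arches (Σ.proj₁ θ) (Σ.proj₁ κ)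
            × ((κ' : F*) → Arches (Σ.proj₁ θ) (Σ.proj₁ κ') → SamePlane (Σ.proj₁ κ') (Σ.proj₁ κ)))
      × ((θ θ' κ : F*) → Arches (Σ.proj₁ θ) (Σ.proj₁ κ) → Arches (Σ.proj₁ θ') (Σ.proj₁ κ)
            → SamePencil (Σ.proj₁ θ) (Σ.proj₁ θ')))
  × (q % 2 ≡ 1 → (θ : F*) →
        (NonzeroSquareInFq (N (Σ.proj₁ θ)) →
           Σ F* λ κ₁ → Σ F* λ κ₂ → ¬ SamePlane (Σ.proj₁ κ₁) (Σ.proj₁ κ₂)
             × Arches (Σ.proj₁ θ) (Σ.proj₁ κ₁) × Arches (Σ.proj₁ θ) (Σ.proj₁ κ₂)
             × ((κ : F*) → Arches (Σ.proj₁ θ) (Σ.proj₁ κ)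
                  → SamePlane (Σ.proj₁ κ) (Σ.proj₁ κ₁) ⊎ SamePlane (Σ.proj₁ κ) (Σ.proj₁ κ₂)))
      × (¬ NonzeroSquareInFq (N (Σ.proj₁ θ)) → (κ : F*) → ¬ Arches (Σ.proj₁ θ) (Σ.proj₁ κ)))
corollary6p2 q q-pp F enumeration with IsPrimePower⇒2≤ q-pp
... | s≤s (s≤s {n = q₂} _) =
  (λ q-even → even⇒unique-plane q-pp q-even , same-plane⇒same-pencil) ,
  (λ q-odd θ → odd⇒two-planes q-odd θ , nonsquare⇒no-plane θ)
  where open PencilsAndPlanes F q₂ enumeration
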